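{- For integers $n\ge d\ge 2$, $\mathrm{Z}_0(K_n^{(d)})=n-d$.
   Context: $K_n^{(d)}$ is the complete $d$-uniform hypergraph with vertex set $[n]$ whose edges are all $d$-element subsets of $[n]$. Zero forcing for a $d$-uniform hypergraph $H$: initially the vertices of a set $B$ are blue and the rest white. A set $S$ of $d-1$ distinct vertices (not required to be blue) can change a white vertex $w$ to blue if (i) $S\cup\{w\}$ is an edge and (ii) whenever $u$ is white and $S\cup\{u\}$ is an edge, $u=w$. $B$ is a zero forcing set if repeated application of this rule colors every vertex blue; $\mathrm{Z}_0(H)$ is the minimum cardinality of a zero forcing set. -}

module Defs where

open import Data.Nat using (ℕ; _∸_; _≤_)
open import Data.Fin using (Fin)
open import Data.Fin.Subset using (Subset; ∣_∣; _∈_; _∉_; _∪_; ⁅_⁆; ⊤)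
open import Data.Product using (Σ; _×_)
open import Relation.Binary.PropositionalEquality using (_≡_)

Hypergraph : ℕ → Set₁
Hypergraph n = Subset n → Set

K : (n d : ℕ) → Hypergraph n
K n d e = ∣ e ∣ ≡ d

Forces : {n : ℕ} (d : ℕ) (H : Hypergraph n) (blue : Subset n) (S : Subset n) (w : Fin n) → Set
Forces d H blue S w =
  (∣ S ∣ ≡ d ∸ 1) × (w ∉ blue) × H (S ∪ ⁅ w ⁆)
  × (∀ u → u ∉ blue → H (S ∪ ⁅ u ⁆) → u ≡ w)

data Step {n : ℕ} (d : ℕ) (H : Hypergraph n) (blue : Subset n) : Subset n → Set where
  step : (S : Subset n) (w : Fin n) → Forces d H blue S w → Step d H blue (blue ∪ ⁅ w ⁆)

data Reaches {n : ℕ} (d : ℕ) (H : Hypergraph n) : Subset n → Subset n → Set where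
  done : ∀ {B} → Reaches d H B B
  more : ∀ {B C D} → Step d H B C → Reaches d H C D → Reaches d H B D

IsZeroForcingSet : {n : ℕ} (d : ℕ) (H : Hypergraph n) → Subset n → Set
IsZeroForcingSet d H B = Reaches d H B ⊤

Z0≡ : {n : ℕ} (d : ℕ) (H : Hypergraph n) (m : ℕ) → Set
Z0≡ {n} d H m =
  Σ (Subset n) (λ B → IsZeroForcingSet d H B × ∣ B ∣ ≡ m)
  × (∀ (B : Subset n) → IsZeroForcingSet d H B → m ≤ ∣ B ∣)

-- In K_n^(d) a set S of d-1 vertices can force only when every white vertex
-- outside S is the forced one, so the white vertices lie in an edge and number
-- at most d. Conversely, if at most d vertices are white, any white w is forced
-- by a (d-1)-set containing all other white vertices but not w; repeating this
-- turns everything blue. Hence B is zero forcing iff |B| ≥ n - d.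
module Submission where

open import Defs
open import Data.Nat using (ℕ; zero; suc; pred; _∸_; _≤_; _<_; z≤n; s≤s; s≤s⁻¹)
open import Data.Nat.Properties
open import Data.Fin using (Fin; zero; suc)
open import Data.Fin.Properties using () renaming (_≟_ to _≟ᶠ_)
open import Data.Fin.Subset
open import Data.Fin.Subset.Properties
open import Data.Vec.Base using ([]; _∷_; here; there)
open import Data.Product using (Σ; _×_; _,_)
open import Data.Sum using (inj₁; inj₂)
open import Function using (_∘_)
open import Relation.Nullary using (yes; no; contradiction)
open import Relation.Binary.PropositionalEquality

private
  variable
    n d : ℕ

x∉p⇒∣p∪⁅x⁆∣≡1+∣p∣ : (p : Subset n) (x : Fin n) → x ∉ p → ∣ p ∪ ⁅ x ⁆ ∣ ≡ suc ∣ p ∣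
x∉p⇒∣p∪⁅x⁆∣≡1+∣p∣ (outside ∷ p) zero    x∉p = cong (suc ∘ ∣_∣) (∪-identityʳ p)
x∉p⇒∣p∪⁅x⁆∣≡1+∣p∣ (inside  ∷ p) zero    x∉p = contradiction here x∉p
x∉p⇒∣p∪⁅x⁆∣≡1+∣p∣ (inside  ∷ p) (suc x) x∉p = cong suc (x∉p⇒∣p∪⁅x⁆∣≡1+∣p∣ p x (x∉p ∘ there))
x∉p⇒∣p∪⁅x⁆∣≡1+∣p∣ (outside ∷ p) (suc x) x∉p = x∉p⇒∣p∪⁅x⁆∣≡1+∣p∣ p x (x∉p ∘ there)

x∈p⇒∣p∪⁅x⁆∣≡∣p∣ : (p : Subset n) (x : Fin n) → x ∈ p → ∣ p ∪ ⁅ x ⁆ ∣ ≡ ∣ p ∣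
x∈p⇒∣p∪⁅x⁆∣≡∣p∣ (inside  ∷ p) zero    _           = cong (suc ∘ ∣_∣) (∪-identityʳ p)
x∈p⇒∣p∪⁅x⁆∣≡∣p∣ (inside  ∷ p) (suc x) (there x∈p) = cong suc (x∈p⇒∣p∪⁅x⁆∣≡∣p∣ p x x∈p)
x∈p⇒∣p∪⁅x⁆∣≡∣p∣ (outside ∷ p) (suc x) (there x∈p) = x∈p⇒∣p∪⁅x⁆∣≡∣p∣ p x x∈p

x∉p⇒∣∁[p∪⁅x⁆]∣≡pred∣∁p∣ : (p : Subset n) (x : Fin n) → x ∉ p → ∣ ∁ (p ∪ ⁅ x ⁆) ∣ ≡ pred ∣ ∁ p ∣
x∉p⇒∣∁[p∪⁅x⁆]∣≡pred∣∁p∣ {n} p x x∉p = begin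
  ∣ ∁ (p ∪ ⁅ x ⁆) ∣  ≡⟨ ∣∁p∣≡n∸∣p∣ (p ∪ ⁅ x ⁆) ⟩
  n ∸ ∣ p ∪ ⁅ x ⁆ ∣  ≡⟨ cong (n ∸_) (x∉p⇒∣p∪⁅x⁆∣≡1+∣p∣ p x x∉p) ⟩
  n ∸ suc ∣ p ∣      ≡⟨ pred[m∸n]≡m∸[1+n] n ∣ p ∣ ⟨
  pred (n ∸ ∣ p ∣)   ≡⟨ cong pred (∣∁p∣≡n∸∣p∣ p) ⟨
  pred ∣ ∁ p ∣       ∎
  where open ≡-Reasoning

0<∣p∣⇒Nonempty : (p : Subset n) → 0 < ∣ p ∣ → Nonempty p
0<∣p∣⇒Nonempty (inside  ∷ p) _ = zero , here
0<∣p∣⇒Nonempty (outside ∷ p) 0<∣p∣ with 0<∣p∣⇒Nonempty p 0<∣p∣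
... | x , x∈p = suc x , there x∈p

∣∁p∣≡0⇒p≡⊤ : (p : Subset n) → ∣ ∁ p ∣ ≡ 0 → p ≡ ⊤
∣∁p∣≡0⇒p≡⊤ {n} p ∣∁p∣≡0 = ∣p∣≡n⇒p≡⊤ (≤-antisym (∣p∣≤n p) n≤∣p∣)
  where
  n≤∣p∣ : n ≤ ∣ p ∣
  n≤∣p∣ = m∸n≡0⇒m≤n (trans (sym (∣∁p∣≡n∸∣p∣ p)) ∣∁p∣≡0)

∣∁p∣≤m⇒n∸m≤∣p∣ : (p : Subset n) {m : ℕ} → ∣ ∁ p ∣ ≤ m → n ∸ m ≤ ∣ p ∣
∣∁p∣≤m⇒n∸m≤∣p∣ {n} p {m} ∣∁p∣≤m = begin
  n ∸ m              ≤⟨ ∸-monoʳ-≤ n ∣∁p∣≤m ⟩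
  n ∸ ∣ ∁ p ∣        ≡⟨ cong (n ∸_) (∣∁p∣≡n∸∣p∣ p) ⟩
  n ∸ (n ∸ ∣ p ∣)    ≡⟨ m∸[m∸n]≡n (∣p∣≤n p) ⟩
  ∣ p ∣              ∎
  where open ≤-Reasoning

-- Decide vertex by vertex from the front: a vertex of C ∖ A is taken exactly
-- when the remaining part of C is too small to reach the target size.
⊆-interpolate : {A C : Subset n} → A ⊆ C → (m : ℕ) → ∣ A ∣ ≤ m → m ≤ ∣ C ∣ →
                Σ (Subset n) λ S → A ⊆ S × S ⊆ C × ∣ S ∣ ≡ m
⊆-interpolate {A = []} {[]} _ zero _ _ = [] , (λ ()) , (λ ()) , refl
⊆-interpolate {A = inside ∷ A} {outside ∷ C} A⊆C m _ _ = contradiction (A⊆C here) λ ()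
⊆-interpolate {A = inside ∷ A} {inside ∷ C} A⊆C (suc m) (s≤s ∣A∣≤m) (s≤s m≤∣C∣)
  with ⊆-interpolate (drop-∷-⊆ A⊆C) m ∣A∣≤m m≤∣C∣
... | S , A⊆S , S⊆C , ∣S∣≡m = inside ∷ S , s⊆s A⊆S , s⊆s S⊆C , cong suc ∣S∣≡m
⊆-interpolate {A = outside ∷ A} {outside ∷ C} A⊆C m ∣A∣≤m m≤∣C∣
  with ⊆-interpolate (drop-∷-⊆ A⊆C) m ∣A∣≤m m≤∣C∣
... | S , A⊆S , S⊆C , ∣S∣≡m = outside ∷ S , s⊆s A⊆S , s⊆s S⊆C , ∣S∣≡m
⊆-interpolate {A = outside ∷ A} {inside ∷ C} A⊆C m ∣A∣≤m m≤1+∣C∣ with m ≤? ∣ C ∣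
... | yes m≤∣C∣ with ⊆-interpolate (drop-∷-⊆ A⊆C) m ∣A∣≤m m≤∣C∣
...   | S , A⊆S , S⊆C , ∣S∣≡m = outside ∷ S , s⊆s A⊆S , out⊆ S⊆C , ∣S∣≡m
⊆-interpolate {A = outside ∷ A} {inside ∷ C} A⊆C m ∣A∣≤m m≤1+∣C∣ | no m≰∣C∣
  with m≤1+∣C∣ | ≰⇒> m≰∣C∣
... | s≤s m-1≤∣C∣ | s≤s ∣C∣≤m-1
  with ⊆-interpolate (drop-∷-⊆ A⊆C) _ (≤-trans (p⊆q⇒∣p∣≤∣q∣ (drop-∷-⊆ A⊆C)) ∣C∣≤m-1) m-1≤∣C∣
... | S , A⊆S , S⊆C , ∣S∣≡m-1 = inside ∷ S , out⊆ A⊆S , s⊆s S⊆C , cong suc ∣S∣≡m-1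

-- The uniformity is written as suc d, so that the forcing sets of K n (suc d)
-- have size exactly d.
Forces⇒∁⊆ : {B S : Subset n} {w : Fin n} → Forces (suc d) (K n (suc d)) B S w → ∁ B ⊆ S ∪ ⁅ w ⁆
Forces⇒∁⊆ {S = S} {w} (∣S∣≡d , _ , _ , only-w) {u} u∈∁B with u ∈? S
... | yes u∈S = p⊆p∪q ⁅ w ⁆ u∈S
... | no  u∉S = subst (_∈ S ∪ ⁅ w ⁆) (sym u≡w) (q⊆p∪q S ⁅ w ⁆ (x∈⁅x⁆ w))
  where
  u≡w : u ≡ w
  u≡w = only-w u (x∈∁p⇒x∉p u∈∁B) (trans (x∉p⇒∣p∪⁅x⁆∣≡1+∣p∣ S u u∉S) (cong suc ∣S∣≡d))

ZeroForcing-K⇒∣∁∣≤ : {B : Subset n} → IsZeroForcingSet (suc d) (K n (suc d)) B → ∣ ∁ B ∣ ≤ suc d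
ZeroForcing-K⇒∣∁∣≤ {n} done = ≤-trans (≤-reflexive ∣∁⊤∣≡0) z≤n
  where
  ∣∁⊤∣≡0 : ∣ ∁ (⊤ {n}) ∣ ≡ 0
  ∣∁⊤∣≡0 = trans (∣∁p∣≡n∸∣p∣ (⊤ {n})) (trans (cong (n ∸_) (∣⊤∣≡n n)) (n∸n≡0 n))
ZeroForcing-K⇒∣∁∣≤ (more (step S w forces@(_ , _ , edge , _)) _) =
  ≤-trans (p⊆q⇒∣p∣≤∣q∣ (Forces⇒∁⊆ {S = S} {w} forces)) (≤-reflexive edge)

Forces-K : {B S : Subset n} {w : Fin n} → ∣ S ∣ ≡ d → w ∉ S → w ∉ B → ∁ (B ∪ ⁅ w ⁆) ⊆ S →
           Forces (suc d) (K n (suc d)) B S w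
Forces-K {d = d} {B} {S} {w} ∣S∣≡d w∉S w∉B white⊆S =
  ∣S∣≡d , w∉B , trans (x∉p⇒∣p∪⁅x⁆∣≡1+∣p∣ S w w∉S) (cong suc ∣S∣≡d) , only-w
  where
  only-w : ∀ u → u ∉ B → ∣ S ∪ ⁅ u ⁆ ∣ ≡ suc d → u ≡ w
  only-w u u∉B edge with u ≟ᶠ w
  ... | yes u≡w = u≡w
  ... | no  u≢w = contradiction (trans (sym edge) (trans (x∈p⇒∣p∪⁅x⁆∣≡∣p∣ S u u∈S) ∣S∣≡d)) 1+n≢n
    where
    u∉B∪w : u ∉ B ∪ ⁅ w ⁆
    u∉B∪w u∈B∪w with x∈p∪q⁻ B ⁅ w ⁆ u∈B∪w
    ... | inj₁ u∈B = u∉B u∈B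
    ... | inj₂ u∈w = u≢w (x∈⁅y⁆⇒x≡y w u∈w)
    u∈S : u ∈ S
    u∈S = white⊆S (x∉p⇒x∈∁p u∉B∪w)

Step-K : {B : Subset n} {w : Fin n} → suc d ≤ n → w ∉ B → ∣ ∁ (B ∪ ⁅ w ⁆) ∣ ≤ d →
         Step (suc d) (K n (suc d)) B (B ∪ ⁅ w ⁆)
Step-K {n} {d} {B} {w} d<n w∉B ∣white∣≤d with ⊆-interpolate white⊆∁w d ∣white∣≤d d≤∣∁w∣
  where
  white⊆∁w : ∁ (B ∪ ⁅ w ⁆) ⊆ ∁ ⁅ w ⁆
  white⊆∁w = p⊆q⇒∁p⊇∁q (q⊆p∪q B ⁅ w ⁆)
  d≤∣∁w∣ : d ≤ ∣ ∁ ⁅ w ⁆ ∣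
  d≤∣∁w∣ = ≤-trans (∸-monoˡ-≤ 1 d<n)
             (≤-reflexive (sym (trans (∣∁p∣≡n∸∣p∣ ⁅ w ⁆) (cong (n ∸_) (∣⁅x⁆∣≡1 w)))))
... | S , white⊆S , S⊆∁w , ∣S∣≡d =
  step S w (Forces-K ∣S∣≡d (x∈p⇒x∉∁p (x∈⁅x⁆ w) ∘ S⊆∁w) w∉B white⊆S)

∣∁∣≤⇒ZeroForcing-K : {B : Subset n} → suc d ≤ n → ∣ ∁ B ∣ ≤ suc d →
                   IsZeroForcingSet (suc d) (K n (suc d)) B
∣∁∣≤⇒ZeroForcing-K {n} {d} {B} d<n ∣∁B∣≤1+d = go _ B refl ∣∁B∣≤1+d
  where
  go : ∀ k (B : Subset n) → ∣ ∁ B ∣ ≡ k → k ≤ suc d → IsZeroForcingSet (suc d) (K n (suc d)) B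
  go zero    B ∣∁B∣≡0 _ rewrite ∣∁p∣≡0⇒p≡⊤ B ∣∁B∣≡0 = done
  go (suc k) B ∣∁B∣≡1+k 1+k≤1+d with 0<∣p∣⇒Nonempty (∁ B) (subst (0 <_) (sym ∣∁B∣≡1+k) (s≤s z≤n))
  ... | w , w∈∁B = more (Step-K d<n w∉B (≤-trans (≤-reflexive ∣white∣≡k) (s≤s⁻¹ 1+k≤1+d)))
                        (go k (B ∪ ⁅ w ⁆) ∣white∣≡k (≤-trans (n≤1+n k) 1+k≤1+d))
    where
    w∉B : w ∉ B
    w∉B = x∈∁p⇒x∉p w∈∁B
    ∣white∣≡k : ∣ ∁ (B ∪ ⁅ w ⁆) ∣ ≡ k
    ∣white∣≡k = trans (x∉p⇒∣∁[p∪⁅x⁆]∣≡pred∣∁p∣ B w w∉B) (cong pred ∣∁B∣≡1+k)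

proposition3p1 : ∀ (n d : ℕ) → 2 ≤ d → d ≤ n → Z0≡ d (K n d) (n ∸ d)
proposition3p1 n zero    () _
proposition3p1 n (suc d) _  d<n with ⊆-interpolate (⊥⊆ {p = ⊤}) (n ∸ suc d) ∣⊥∣≤n∸d n∸d≤∣⊤∣
  where
  ∣⊥∣≤n∸d : ∣ ⊥ {n} ∣ ≤ n ∸ suc d
  ∣⊥∣≤n∸d = ≤-trans (≤-reflexive (∣⊥∣≡0 n)) z≤n
  n∸d≤∣⊤∣ : n ∸ suc d ≤ ∣ ⊤ {n} ∣
  n∸d≤∣⊤∣ = ≤-trans (m∸n≤m n (suc d)) (≤-reflexive (sym (∣⊤∣≡n n)))
... | B , _ , _ , ∣B∣≡n∸[1+d] =
  (B , ∣∁∣≤⇒ZeroForcing-K d<n (≤-reflexive ∣∁B∣≡1+d) , ∣B∣≡n∸[1+d]) ,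
  λ B′ zf → ∣∁p∣≤m⇒n∸m≤∣p∣ B′ (ZeroForcing-K⇒∣∁∣≤ zf)
  where
  ∣∁B∣≡1+d : ∣ ∁ B ∣ ≡ suc d
  ∣∁B∣≡1+d = trans (∣∁p∣≡n∸∣p∣ B) (trans (cong (n ∸_) ∣B∣≡n∸[1+d]) (m∸[m∸n]≡n d<n))
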